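{- Let $\Omega=(X_1\times\cdots\times X_n,\ \mu_1\times\cdots\times\mu_n)$ be a finite $n$-wise product probability space, let $(Z,\rho)$ be a semimetric space, and let $T$ be a separated deterministic decision tree computing $f:X\to Z$, where $X=X_1\times\cdots\times X_n$. Then \[ \mathbf{Vr}[f]=\sum_{i=1}^n\delta_i(T)\,\mathbf{Inf}_i(f). \]
   Context: A semimetric $\rho$ satisfies $\rho\ge0$, $\rho(z,z)=0$, $\rho(z,z')=\rho(z',z)$. A deterministic decision tree (DDT) on $X$ is a rooted tree whose internal nodes $v$ are labelled by coordinates $i_v\in[n]$ with outgoing arcs in bijection with $X_{i_v}$, labels distinct along each root-leaf path, and leaves labelled in $Z$; it computes $f$ if it outputs $f(x)$ on every input $x$. The subtree below any node is itself a decision tree on $X$. $T$ is separated if for every two subtrees $T',T''$ of $T$ and every input $x\in X$, whenever $T'$ and $T''$ output different values on $x$, the sets of coordinates they query on input $x$ are disjoint. $\delta_i(T)=\Pr_{x\sim\mu}[T\text{ queries }x_i]$. $\mathbf{Vr}[f]=\mathbf{E}[\rho(f(x),f(y))]$ for independent $x,y\sim\mu$. $\mathbf{Inf}_i(f)=\mathbf{E}[\rho(f(x),f(x^{(i)}))]$ where $x\sim\mu$ and $x^{(i)}$ is $x$ with its $i$th coordinate replaced by an independent sample from $\mu_i$. -}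

module Defs where

open import Level using (Level; _⊔_)
open import Data.Nat using (ℕ; zero; suc)
open import Data.Fin using (Fin; zero; suc; _≟_)
open import Data.Bool using (Bool; true; false; if_then_else_; _∨_)
open import Data.List using (List; []; _∷_; _++_; concatMap; map; foldr)
open import Data.List.Membership.Propositional using (_∈_)
open import Data.Empty using (⊥)
open import Relation.Nullary using (¬_)
open import Relation.Nullary.Decidable using (⌊_⌋)
open import Relation.Binary.PropositionalEquality using (_≡_)
open import Relation.Binary.Structures using (IsTotalOrder)
open import Algebra.Bundles using (CommutativeRing)

-- Scalars: an ordered commutative ring (the real numbers ℝ are an
-- instance; agda-stdlib has no reals, so we work over an arbitrary one).

record OrderedCommRing (c ℓ₁ ℓ₂ : Level) : Set (Level.suc (c ⊔ ℓ₁ ⊔ ℓ₂)) where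
  field
    commutativeRing : CommutativeRing c ℓ₁
  open CommutativeRing commutativeRing public
  field
    _≤_          : Carrier → Carrier → Set ℓ₂
    isTotalOrder : IsTotalOrder _≈_ _≤_
    +-mono-≤     : ∀ {x y} z → x ≤ y → (x + z) ≤ (y + z)
    *-nonneg     : ∀ {x y} → 0# ≤ x → 0# ≤ y → 0# ≤ (x * y)

Input : (n : ℕ) → (Fin n → ℕ) → Set
Input n k = (i : Fin n) → Fin (k i)

allFin : (m : ℕ) → List (Fin m)
allFin zero    = []
allFin (suc m) = zero ∷ map suc (allFin m)

consI : ∀ {n} {k : Fin (suc n) → ℕ} → Fin (k zero) → Input n (λ i → k (suc i)) → Input (suc n) k
consI a x zero    = a
consI a x (suc i) = x i

allInputs : (n : ℕ) (k : Fin n → ℕ) → List (Input n k)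
allInputs zero    k = (λ ()) ∷ []
allInputs (suc n) k =
  concatMap (λ a → map (consI {k = k} a) (allInputs n (λ i → k (suc i)))) (allFin (k zero))

module Prob {c ℓ₁ ℓ₂} (R : OrderedCommRing c ℓ₁ ℓ₂) where
  open OrderedCommRing R using (Carrier; _≈_; _≤_; _+_; _*_; 0#; 1#)

  sumL : ∀ {a} {A : Set a} → List A → (A → Carrier) → Carrier
  sumL xs g = foldr (λ x s → g x + s) 0# xs

  prodFin : (n : ℕ) → (Fin n → Carrier) → Carrier
  prodFin zero    g = 1#
  prodFin (suc n) g = g zero * prodFin n (λ i → g (suc i))

  IsProbability : (m : ℕ) → (Fin m → Carrier) → Set (ℓ₁ ⊔ ℓ₂)
  IsProbability m p = (∀ a → 0# ≤ p a) Data.Product.× (sumL (allFin m) p ≈ 1#)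
    where import Data.Product

  E : ∀ {n} {k : Fin n → ℕ} → ((i : Fin n) → Fin (k i) → Carrier)
      → (Input n k → Carrier) → Carrier
  E {n} {k} μ g = sumL (allInputs n k) (λ x → prodFin n (λ i → μ i (x i)) * g x)

  record IsSemimetric {z} {Z : Set z} (ρ : Z → Z → Carrier) : Set (z ⊔ ℓ₁ ⊔ ℓ₂) where
    field
      nonneg : ∀ u v → 0# ≤ ρ u v
      refl0  : ∀ u → ρ u u ≈ 0#
      sym    : ∀ u v → ρ u v ≈ ρ v u

  replace : ∀ {n} {k : Fin n → ℕ} → Fin n → Input n k → Input n k → Input n k
  replace i x y j = if ⌊ j ≟ i ⌋ then y j else x j

  indicator : Bool → Carrier
  indicator true  = 1#
  indicator false = 0#

data DT {z} (n : ℕ) (k : Fin n → ℕ) (Z : Set z) : Set z where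
  leaf : Z → DT n k Z
  node : (i : Fin n) → (Fin (k i) → DT n k Z) → DT n k Z

module _ {z} {n : ℕ} {k : Fin n → ℕ} {Z : Set z} where

  eval : DT n k Z → Input n k → Z
  eval (leaf v)   x = v
  eval (node i t) x = eval (t (x i)) x

  queried : DT n k Z → Input n k → List (Fin n)
  queried (leaf v)   x = []
  queried (node i t) x = i ∷ queried (t (x i)) x

  queriesB : DT n k Z → Input n k → Fin n → Bool
  queriesB (leaf v)   x j = false
  queriesB (node i t) x j = ⌊ i ≟ j ⌋ ∨ queriesB (t (x i)) x j

  -- labels are distinct along every root-leaf path:
  -- ValidFrom used T means no label in T's paths repeats or lies in `used`
  data ValidFrom (used : List (Fin n)) : DT n k Z → Set z where
    leaf : ∀ v → ValidFrom used (leaf v)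
    node : ∀ i t → ¬ (i ∈ used) → (∀ a → ValidFrom (i ∷ used) (t a))
         → ValidFrom used (node i t)

  IsDDT : DT n k Z → Set z
  IsDDT T = ValidFrom [] T

  data Subtree : DT n k Z → DT n k Z → Set z where
    here  : ∀ {T} → Subtree T T
    there : ∀ {S i t} a → Subtree S (t a) → Subtree S (node i t)

  Computes : DT n k Z → (Input n k → Z) → Set z
  Computes T f = ∀ x → eval T x ≡ f x

  Separated : DT n k Z → Set z
  Separated T = ∀ T′ T″ → Subtree T′ T → Subtree T″ T → ∀ x →
    ¬ (eval T′ x ≡ eval T″ x) →
    ∀ i → i ∈ queried T′ x → i ∈ queried T″ x → ⊥

module Quantities {c ℓ₁ ℓ₂} (R : OrderedCommRing c ℓ₁ ℓ₂)
                  {z} {n : ℕ} {k : Fin n → ℕ} {Z : Set z}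
                  (μ : (i : Fin n) → Fin (k i) → OrderedCommRing.Carrier R)
                  (ρ : Z → Z → OrderedCommRing.Carrier R) where
  open OrderedCommRing R using (Carrier; _*_)
  open Prob R

  Vr : (Input n k → Z) → Carrier
  Vr f = E μ (λ x → E μ (λ y → ρ (f x) (f y)))

  -- Inf_i(f) = E ρ(f x, f x⁽ⁱ⁾), x⁽ⁱ⁾ = x with coordinate i replaced by
  -- y_i for an independent y ∼ μ (so y_i ∼ μ_i independently of x)
  Inf : Fin n → (Input n k → Z) → Carrier
  Inf i f = E μ (λ x → E μ (λ y → ρ (f x) (f (replace i x y))))

  δ : Fin n → DT n k Z → Carrier
  δ i T = E μ (λ x → indicator (queriesB T x i))

  sumδInf : DT n k Z → (Input n k → Z) → Carrier
  sumδInf T f = sumL (allFin n) (λ i → δ i T * Inf i f)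

{-# OPTIONS --safe #-}
module Submission where

-- For a subtree S of T, induction on S proves
--   E_{x,y} ρ(S x, T y) = E_x ρ(S x, T x) + Σ_j δ_j(S) Inf_j(T),
-- and S = T is the theorem, the diagonal term being 0.  At a node S querying i, the subtrees never
-- query i again, so resampling x_i reduces the left side to the average over the children; on
-- the right, swapping x_i with y_i of an independent copy y turns the average of the children's
-- diagonal terms into E_{x,y} ρ(S x, T x^(i)).  This equals E ρ(S x, T x) + Inf_i(T): when T does
-- not query i on x, T x^(i) = T x; when it does, S and T share the query i, so separation forces
-- S x = T x.  The extra Inf_i(T) is exactly what the query at the root adds to Σ_j δ_j(S) Inf_j(T).

open import Defs
open import Data.Nat using (ℕ)
open import Data.Fin using (Fin; zero; suc; _≟_)

open import Level using (Level)
import Data.Nat as ℕ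
open import Data.Bool using (Bool; true; false; if_then_else_; _∨_)
import Data.Bool.Properties as Bool
open import Data.List using (List; []; _∷_; _++_; map; concatMap)
open import Data.List.Relation.Unary.Any using (here; there)
open import Data.List.Membership.Propositional using (_∈_)
open import Data.Sum using (_⊎_; inj₁; inj₂; [_,_]′)
open import Data.Product using (proj₂)
open import Data.Empty using (⊥)
open import Function using (_∘_; const)
open import Relation.Nullary using (¬_; yes; no)
open import Relation.Nullary.Decidable using (⌊_⌋; dec-no; decidable-stable)
open import Relation.Binary.Core using (Rel; _Preserves_⟶_; _Preserves₂_⟶_⟶_)
open import Relation.Binary.Structures using (IsTotalOrder)
open import Relation.Binary.PropositionalEquality as ≡ using (_≡_; cong; cong₂; ≡-≟-identity)
import Relation.Binary.Reasoning.Setoid as ≈-Reasoning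
import Algebra.Properties.CommutativeSemigroup as CommutativeSemigroupProperties

private
  variable
    a b : Level
    A : Set a
    B : Set b
    n : ℕ
    k : Fin n → ℕ

-- There is no function extensionality, so every integrand over inputs has to be shown to
-- respect pointwise equality.
_≐_ : Rel (Input n k) _
x ≐ y = ∀ i → x i ≡ y i

isYes-suc-≟ : (i j : Fin n) → ⌊ suc i ≟ suc j ⌋ ≡ ⌊ i ≟ j ⌋
isYes-suc-≟ i j with i ≟ j
... | yes _ = ≡.refl
... | no  _ = ≡.refl

module _ {c ℓ₁ ℓ₂} (R : OrderedCommRing c ℓ₁ ℓ₂) where
  open OrderedCommRing R hiding (zero)
  open Prob R
  open ≈-Reasoning setoid
  private
    module +-Properties = CommutativeSemigroupProperties +-commutativeSemigroup
    module *-Properties = CommutativeSemigroupProperties *-commutativeSemigroup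

  sumL-cong : (xs : List A) {g h : A → Carrier} → (∀ x → g x ≈ h x) → sumL xs g ≈ sumL xs h
  sumL-cong []       g≈h = refl
  sumL-cong (x ∷ xs) g≈h = +-cong (g≈h x) (sumL-cong xs g≈h)

  sumL-zero : (xs : List A) → sumL xs (const 0#) ≈ 0#
  sumL-zero []       = refl
  sumL-zero (x ∷ xs) = trans (+-identityˡ _) (sumL-zero xs)

  sumL-+ : (xs : List A) (g h : A → Carrier) → sumL xs (λ x → g x + h x) ≈ sumL xs g + sumL xs h
  sumL-+ []       g h = sym (+-identityˡ 0#)
  sumL-+ (x ∷ xs) g h = trans (+-cong refl (sumL-+ xs g h)) (+-Properties.interchange _ _ _ _)

  sumL-*ˡ : (xs : List A) (w : Carrier) (g : A → Carrier) → sumL xs (λ x → w * g x) ≈ w * sumL xs g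
  sumL-*ˡ []       w g = sym (zeroʳ w)
  sumL-*ˡ (x ∷ xs) w g = trans (+-cong refl (sumL-*ˡ xs w g)) (sym (distribˡ w _ _))

  sumL-swap : (xs : List A) (ys : List B) (g : A → B → Carrier) →
              sumL xs (λ x → sumL ys (g x)) ≈ sumL ys (λ y → sumL xs (λ x → g x y))
  sumL-swap []       ys g = sym (sumL-zero ys)
  sumL-swap (x ∷ xs) ys g = trans (+-cong refl (sumL-swap xs ys g)) (sym (sumL-+ ys _ _))

  weighted-sumL-swap : (xs : List A) (ys : List B) (v : A → Carrier) (w : B → Carrier)
                       (K : A → B → Carrier) →
    sumL xs (λ x → v x * sumL ys (λ y → w y * K x y)) ≈ sumL ys (λ y → w y * sumL xs (λ x → v x * K x y))
  weighted-sumL-swap xs ys v w K = begin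
    sumL xs (λ x → v x * sumL ys (λ y → w y * K x y))
      ≈⟨ sumL-cong xs (λ x → sym (sumL-*ˡ ys (v x) _)) ⟩
    sumL xs (λ x → sumL ys (λ y → v x * (w y * K x y))) ≈⟨ sumL-swap xs ys _ ⟩
    sumL ys (λ y → sumL xs (λ x → v x * (w y * K x y)))
      ≈⟨ sumL-cong ys (λ y → sumL-cong xs (λ x → *-Properties.x∙yz≈y∙xz (v x) (w y) (K x y))) ⟩
    sumL ys (λ y → sumL xs (λ x → w y * (v x * K x y))) ≈⟨ sumL-cong ys (λ y → sumL-*ˡ xs (w y) _) ⟩
    sumL ys (λ y → w y * sumL xs (λ x → v x * K x y))   ∎

  sumL-++ : (xs ys : List A) (g : A → Carrier) → sumL (xs ++ ys) g ≈ sumL xs g + sumL ys g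
  sumL-++ []       ys g = sym (+-identityˡ _)
  sumL-++ (x ∷ xs) ys g = trans (+-cong refl (sumL-++ xs ys g)) (sym (+-assoc _ _ _))

  sumL-map : (h : B → A) (xs : List B) (g : A → Carrier) → sumL (map h xs) g ≈ sumL xs (g ∘ h)
  sumL-map h []       g = refl
  sumL-map h (x ∷ xs) g = +-cong refl (sumL-map h xs g)

  sumL-concatMap : (F : B → List A) (xs : List B) (g : A → Carrier) →
                   sumL (concatMap F xs) g ≈ sumL xs (λ x → sumL (F x) g)
  sumL-concatMap F []       g = refl
  sumL-concatMap F (x ∷ xs) g = trans (sumL-++ (F x) _ g) (+-cong refl (sumL-concatMap F xs g))

  sumL-indicator-≟ : (i : Fin n) (h : Fin n → Carrier) →
                     sumL (allFin n) (λ j → indicator ⌊ i ≟ j ⌋ * h j) ≈ h i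
  sumL-indicator-≟ {ℕ.suc n} zero h = begin
    1# * h zero + sumL (map suc (allFin n)) (λ j → indicator ⌊ zero ≟ j ⌋ * h j)
      ≈⟨ +-cong (*-identityˡ _) (sumL-map suc (allFin n) _) ⟩
    h zero + sumL (allFin n) (λ j → 0# * h (suc j))
      ≈⟨ +-cong refl (trans (sumL-cong (allFin n) (λ j → zeroˡ _)) (sumL-zero (allFin n))) ⟩
    h zero + 0#
      ≈⟨ +-identityʳ _ ⟩
    h zero ∎
  sumL-indicator-≟ {ℕ.suc n} (suc i) h = begin
    0# * h zero + sumL (map suc (allFin n)) (λ j → indicator ⌊ suc i ≟ j ⌋ * h j)
      ≈⟨ +-cong (zeroˡ _) (sumL-map suc (allFin n) _) ⟩
    0# + sumL (allFin n) (λ j → indicator ⌊ suc i ≟ suc j ⌋ * h (suc j))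
      ≈⟨ +-identityˡ _ ⟩
    sumL (allFin n) (λ j → indicator ⌊ suc i ≟ suc j ⌋ * h (suc j))
      ≈⟨ sumL-cong (allFin n) (λ j → *-cong (reflexive (cong indicator (isYes-suc-≟ i j))) refl) ⟩
    sumL (allFin n) (λ j → indicator ⌊ i ≟ j ⌋ * h (suc j))
      ≈⟨ sumL-indicator-≟ i (h ∘ suc) ⟩
    h (suc i) ∎

  indicator-∨ : ∀ p q → (p ≡ true → q ≡ false) → indicator (p ∨ q) ≈ indicator p + indicator q
  indicator-∨ true  q p⇒¬q rewrite p⇒¬q ≡.refl = sym (+-identityʳ _)
  indicator-∨ false q p⇒¬q = sym (+-identityˡ _)

  Weights : (n : ℕ) → (Fin n → ℕ) → Set c
  Weights n k = (i : Fin n) → Fin (k i) → Carrier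

  weight : Weights n k → Input n k → Carrier
  weight {n} μ x = prodFin n (λ i → μ i (x i))

  E² : Weights n k → (Input n k → Input n k → Carrier) → Carrier
  E² μ g = E μ (λ x → E μ (g x))

  module _ {n : ℕ} {k : Fin n → ℕ} (μ : Weights n k) where

    E-cong : {g h : Input n k → Carrier} → (∀ x → g x ≈ h x) → E μ g ≈ E μ h
    E-cong g≈h = sumL-cong (allInputs n k) (λ x → *-cong refl (g≈h x))

    E²-cong : {g h : Input n k → Input n k → Carrier} → (∀ x y → g x y ≈ h x y) → E² μ g ≈ E² μ h
    E²-cong g≈h = E-cong (λ x → E-cong (g≈h x))

    E-zero : E μ (const 0#) ≈ 0#
    E-zero = trans (sumL-cong (allInputs n k) (λ x → zeroʳ _)) (sumL-zero (allInputs n k))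

    E-+ : (g h : Input n k → Carrier) → E μ (λ x → g x + h x) ≈ E μ g + E μ h
    E-+ g h = trans (sumL-cong (allInputs n k) (λ x → distribˡ _ _ _)) (sumL-+ (allInputs n k) _ _)

    E-*ˡ : (w : Carrier) (g : Input n k → Carrier) → E μ (λ x → w * g x) ≈ w * E μ g
    E-*ˡ w g = trans (sumL-cong (allInputs n k) (λ x → *-Properties.x∙yz≈y∙xz _ w _))
                     (sumL-*ˡ (allInputs n k) w _)

    E-*ʳ : (w : Carrier) (g : Input n k → Carrier) → E μ (λ x → g x * w) ≈ E μ g * w
    E-*ʳ w g = trans (E-cong (λ x → *-comm (g x) w)) (trans (E-*ˡ w g) (*-comm w _))

    E-sumL : (ys : List B) (h : Input n k → B → Carrier) →
             E μ (λ x → sumL ys (h x)) ≈ sumL ys (λ y → E μ (λ x → h x y))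
    E-sumL ys h = trans (sumL-cong (allInputs n k) (λ x → sym (sumL-*ˡ ys (weight μ x) (h x))))
                        (sumL-swap (allInputs n k) ys (λ x y → weight μ x * h x y))

  E-swap : ∀ {m} {l : Fin m → ℕ} (μ : Weights n k) (ν : Weights m l)
           (g : Input n k → Input m l → Carrier) →
           E μ (λ x → E ν (g x)) ≈ E ν (λ y → E μ (λ x → g x y))
  E-swap {m = m} {l} μ ν g =
    trans (E-sumL μ (allInputs m l) _) (sumL-cong (allInputs m l) (λ y → E-*ˡ μ _ (λ x → g x y)))

  E-cons : {k : Fin (ℕ.suc n) → ℕ} (μ : Weights (ℕ.suc n) k) (g : Input (ℕ.suc n) k → Carrier) →
           E μ g ≈ sumL (allFin (k zero)) (λ a → μ zero a * E (μ ∘ suc) (g ∘ consI a))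
  E-cons {n} {k} μ g = begin
    E μ g
      ≈⟨ sumL-concatMap _ (allFin (k zero)) _ ⟩
    sumL (allFin (k zero)) (λ a → sumL (map (consI a) xs) (λ x → weight μ x * g x))
      ≈⟨ sumL-cong (allFin (k zero)) (λ a → sumL-map (consI a) xs (λ x → weight μ x * g x)) ⟩
    sumL (allFin (k zero)) (λ a → sumL xs (λ x → (μ zero a * weight (μ ∘ suc) x) * g (consI a x)))
      ≈⟨ sumL-cong (allFin (k zero)) (λ a →
           trans (sumL-cong xs (λ x → *-assoc _ _ _)) (sumL-*ˡ xs _ _)) ⟩
    sumL (allFin (k zero)) (λ a → μ zero a * E (μ ∘ suc) (g ∘ consI a)) ∎
    where
      xs = allInputs n (k ∘ suc)

  E²-cons : {k : Fin (ℕ.suc n) → ℕ} (μ : Weights (ℕ.suc n) k)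
            (g : Input (ℕ.suc n) k → Input (ℕ.suc n) k → Carrier) →
    E² μ g ≈ sumL (allFin (k zero)) (λ a → μ zero a * sumL (allFin (k zero)) (λ b → μ zero b *
               E² (μ ∘ suc) (λ x y → g (consI a x) (consI b y))))
  E²-cons {k = k} μ g = trans (E-cons μ _) (sumL-cong as (λ a → *-cong refl (inner a)))
    where
      as = allFin (k zero)
      inner : ∀ a → E (μ ∘ suc) (λ x → E μ (g (consI a x)))
                    ≈ sumL as (λ b → μ zero b * E² (μ ∘ suc) (λ x y → g (consI a x) (consI b y)))
      inner a = begin
        E (μ ∘ suc) (λ x → E μ (g (consI a x)))
          ≈⟨ E-cong (μ ∘ suc) (λ x → E-cons μ _) ⟩
        E (μ ∘ suc) (λ x → sumL as (λ b → μ zero b * E (μ ∘ suc) (λ y → g (consI a x) (consI b y))))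
          ≈⟨ E-sumL (μ ∘ suc) as _ ⟩
        sumL as (λ b → E (μ ∘ suc) (λ x → μ zero b * E (μ ∘ suc) (λ y → g (consI a x) (consI b y))))
          ≈⟨ sumL-cong as (λ b → E-*ˡ (μ ∘ suc) _ _) ⟩
        sumL as (λ b → μ zero b * E² (μ ∘ suc) (λ x y → g (consI a x) (consI b y))) ∎

  E-const : (μ : Weights n k) → (∀ i → IsProbability (k i) (μ i)) → ∀ w → E μ (const w) ≈ w
  E-const {ℕ.zero}  μ pr w = trans (+-identityʳ _) (*-identityˡ w)
  E-const {ℕ.suc n} {k} μ pr w = begin
    E μ (const w)
      ≈⟨ E-cons μ _ ⟩
    sumL (allFin (k zero)) (λ a → μ zero a * E (μ ∘ suc) (const w))
      ≈⟨ sumL-cong (allFin (k zero)) (λ a →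
           trans (*-cong refl (E-const (μ ∘ suc) (pr ∘ suc) w)) (*-comm _ w)) ⟩
    sumL (allFin (k zero)) (λ a → w * μ zero a)
      ≈⟨ sumL-*ˡ (allFin (k zero)) w _ ⟩
    w * sumL (allFin (k zero)) (μ zero)
      ≈⟨ *-cong refl (proj₂ (pr zero)) ⟩
    w * 1#
      ≈⟨ *-identityʳ w ⟩
    w ∎

  consI-cong : {k : Fin (ℕ.suc n) → ℕ} (a : Fin (k zero)) {x x′ : Input n (k ∘ suc)} →
               x ≐ x′ → consI {k = k} a x ≐ consI a x′
  consI-cong a x≐x′ zero    = ≡.refl
  consI-cong a x≐x′ (suc j) = x≐x′ j

  replace-cong : (i : Fin n) {x x′ y y′ : Input n k} → x ≐ x′ → y ≐ y′ →
                 replace i x y ≐ replace i x′ y′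
  replace-cong i x≐x′ y≐y′ j = cong₂ (λ u v → if ⌊ j ≟ i ⌋ then u else v) (y≐y′ j) (x≐x′ j)

  replace-at : (i : Fin n) (x y : Input n k) → replace i x y i ≡ y i
  replace-at i x y = cong (λ d → if ⌊ d ⌋ then y i else x i) (≡-≟-identity _≟_ ≡.refl)

  replace-involutive : (i : Fin n) (x y : Input n k) → replace i (replace i x y) (replace i y x) ≐ x
  replace-involutive i x y j = if-if ⌊ j ≟ i ⌋
    where
      if-if : ∀ p → (if p then (if p then x j else y j) else (if p then y j else x j)) ≡ x j
      if-if true  = ≡.refl
      if-if false = ≡.refl

  replace-zero-consI : {k : Fin (ℕ.suc n) → ℕ} (a b : Fin (k zero)) (x y : Input n (k ∘ suc)) →
                       consI {k = k} b x ≐ replace zero (consI a x) (consI b y)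
  replace-zero-consI a b x y zero    = ≡.refl
  replace-zero-consI a b x y (suc j) = ≡.refl

  replace-suc-consI : {k : Fin (ℕ.suc n) → ℕ} (i : Fin n) (a b : Fin (k zero)) (x y : Input n (k ∘ suc)) →
                      consI {k = k} a (replace i x y) ≐ replace (suc i) (consI a x) (consI b y)
  replace-suc-consI i a b x y zero    = ≡.refl
  replace-suc-consI i a b x y (suc j) = cong (λ p → if p then y j else x j) (≡.sym (isYes-suc-≟ j i))

  E²-exchange : (μ : Weights n k) (i : Fin n) (g : Input n k → Input n k → Carrier) →
                g Preserves₂ _≐_ ⟶ _≐_ ⟶ _≈_ →
                E² μ g ≈ E² μ (λ x y → g (replace i x y) (replace i y x))
  E²-exchange {ℕ.suc n} {k} μ zero g g-cong = begin
    E² μ g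
      ≈⟨ E²-cons μ g ⟩
    sumL as (λ a → μ zero a * sumL as (λ b → μ zero b * E² μ′ (λ x y → g (consI a x) (consI b y))))
      ≈⟨ weighted-sumL-swap as as (μ zero) (μ zero) _ ⟩
    sumL as (λ b → μ zero b * sumL as (λ a → μ zero a * E² μ′ (λ x y → g (consI a x) (consI b y))))
      ≈⟨ sumL-cong as (λ b → *-cong refl (sumL-cong as (λ a → *-cong refl (E²-cong μ′ (λ x y →
           g-cong (replace-zero-consI b a x y) (replace-zero-consI a b y x)))))) ⟩
    sumL as (λ b → μ zero b * sumL as (λ a → μ zero a * E² μ′ (λ x y →
      g (replace zero (consI b x) (consI a y)) (replace zero (consI a y) (consI b x)))))
      ≈˘⟨ E²-cons μ _ ⟩
    E² μ (λ x y → g (replace zero x y) (replace zero y x)) ∎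
    where
      as = allFin (k zero)
      μ′ = μ ∘ suc
  E²-exchange {ℕ.suc n} {k} μ (suc i) g g-cong = begin
    E² μ g
      ≈⟨ E²-cons μ g ⟩
    sumL as (λ a → μ zero a * sumL as (λ b → μ zero b * E² μ′ (λ x y → g (consI a x) (consI b y))))
      ≈⟨ sumL-cong as (λ a → *-cong refl (sumL-cong as (λ b → *-cong refl (exchange-tail a b)))) ⟩
    sumL as (λ a → μ zero a * sumL as (λ b → μ zero b * E² μ′ (λ x y →
      g (replace (suc i) (consI a x) (consI b y)) (replace (suc i) (consI b y) (consI a x)))))
      ≈˘⟨ E²-cons μ _ ⟩
    E² μ (λ x y → g (replace (suc i) x y) (replace (suc i) y x)) ∎
    where
      as = allFin (k zero)
      μ′ = μ ∘ suc
      exchange-tail : ∀ a b → E² μ′ (λ x y → g (consI a x) (consI b y))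
        ≈ E² μ′ (λ x y → g (replace (suc i) (consI a x) (consI b y)) (replace (suc i) (consI b y) (consI a x)))
      exchange-tail a b = begin
        E² μ′ (λ x y → g (consI a x) (consI b y))
          ≈⟨ E²-exchange μ′ i _ (λ x≐x′ y≐y′ → g-cong (consI-cong a x≐x′) (consI-cong b y≐y′)) ⟩
        E² μ′ (λ x y → g (consI a (replace i x y)) (consI b (replace i y x)))
          ≈⟨ E²-cong μ′ (λ x y → g-cong (replace-suc-consI i a b x y) (replace-suc-consI i b a y x)) ⟩
        E² μ′ (λ x y → g (replace (suc i) (consI a x) (consI b y)) (replace (suc i) (consI b y) (consI a x))) ∎

  E-resample : (μ : Weights n k) → (∀ i → IsProbability (k i) (μ i)) → (i : Fin n)
               (h : Input n k → Carrier) → h Preserves _≐_ ⟶ _≈_ →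
               E μ h ≈ E² μ (λ x y → h (replace i x y))
  E-resample μ pr i h h-cong = begin
    E μ h                                           ≈˘⟨ E-cong μ (λ x → E-const μ pr (h x)) ⟩
    E² μ (λ x y → h x)                              ≈⟨ E²-exchange μ i _ (λ x≐x′ _ → h-cong x≐x′) ⟩
    E² μ (λ x y → h (replace i x y))                ∎

  E-decouple : (μ : Weights n k) → (∀ i → IsProbability (k i) (μ i)) → (i : Fin n)
               (φ : Fin (k i) → Input n k → Carrier) → (∀ a → φ a Preserves _≐_ ⟶ _≈_) →
               (∀ a x y → φ a (replace i x y) ≈ φ a x) →
               E μ (λ x → φ (x i) x) ≈ E² μ (λ z x → φ (z i) x)
  E-decouple μ pr i φ φ-cong φ-ignores-i = begin
    E μ (λ x → φ (x i) x)                           ≈⟨ E-resample μ pr i _ φ-diag-cong ⟩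
    E² μ (λ x z → φ (replace i x z i) (replace i x z))
      ≈⟨ E²-cong μ (λ x z → trans (reflexive (cong (λ a → φ a (replace i x z)) (replace-at i x z)))
                                  (φ-ignores-i (z i) x z)) ⟩
    E² μ (λ x z → φ (z i) x)                        ≈⟨ E-swap μ μ _ ⟩
    E² μ (λ z x → φ (z i) x)                        ∎
    where
      φ-diag-cong : (λ x → φ (x i) x) Preserves _≐_ ⟶ _≈_
      φ-diag-cong {x} {x′} x≐x′ = trans (φ-cong (x i) x≐x′) (reflexive (cong (λ a → φ a x′) (x≐x′ i)))

  module _ {z} {Z : Set z} where

    eval-cong : (T : DT n k Z) {x x′ : Input n k} → x ≐ x′ → eval T x ≡ eval T x′
    eval-cong (leaf v)   x≐x′ = ≡.refl
    eval-cong (node j t) {x} {x′} x≐x′ =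
      ≡.trans (eval-cong (t (x j)) x≐x′) (cong (λ a → eval (t a) x′) (x≐x′ j))

    queriesB-cong : (T : DT n k Z) {x x′ : Input n k} → x ≐ x′ →
                    ∀ i → queriesB T x i ≡ queriesB T x′ i
    queriesB-cong (leaf v)   x≐x′ i = ≡.refl
    queriesB-cong (node j t) {x} {x′} x≐x′ i = cong (⌊ j ≟ i ⌋ ∨_)
      (≡.trans (queriesB-cong (t (x j)) x≐x′ i) (cong (λ a → queriesB (t a) x′ i) (x≐x′ j)))

    eval-replace-unqueried : (T : DT n k Z) (x y : Input n k) {i : Fin n} →
                             queriesB T x i ≡ false → eval T (replace i x y) ≡ eval T x
    eval-replace-unqueried (leaf v)   x y e = ≡.refl
    eval-replace-unqueried (node j t) x y {i} e with j ≟ i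
    eval-replace-unqueried (node j t) x y () | yes _
    ... | no _ = eval-replace-unqueried (t (x j)) x y e

    queriesB-replace-unqueried : (T : DT n k Z) (x y : Input n k) {i : Fin n} →
                                 queriesB T x i ≡ false → ∀ l → queriesB T (replace i x y) l ≡ queriesB T x l
    queriesB-replace-unqueried (leaf v)   x y e l = ≡.refl
    queriesB-replace-unqueried (node j t) x y {i} e l with j ≟ i
    queriesB-replace-unqueried (node j t) x y () l | yes _
    ... | no _ = cong (⌊ j ≟ l ⌋ ∨_) (queriesB-replace-unqueried (t (x j)) x y e l)

    used-unqueried : ∀ {used} {T : DT n k Z} → ValidFrom used T →
                     ∀ {i} → i ∈ used → ∀ x → queriesB T x i ≡ false
    used-unqueried (leaf v)           i∈used x = ≡.refl
    used-unqueried (node j t j∉used valid) {i} i∈used x =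
      cong₂ _∨_ (cong ⌊_⌋ (dec-no (j ≟ i) (λ { ≡.refl → j∉used i∈used })))
                (used-unqueried (valid (x j)) (there i∈used) x)

    queriesB⇒∈queried : (T : DT n k Z) (x : Input n k) {i : Fin n} →
                        queriesB T x i ≡ true → i ∈ queried T x
    queriesB⇒∈queried (leaf v)   x ()
    queriesB⇒∈queried (node j t) x {i} e with j ≟ i
    ... | yes ≡.refl = here ≡.refl
    ... | no  _      = there (queriesB⇒∈queried (t (x j)) x e)

  -- Separation only yields ¬ ¬ (u ≡ v), as Z has no decidable equality.  Comparing φ u with the
  -- fixed value φ v in both orders gives two Booleans that agree at v, hence (Bool equality being
  -- ¬¬-stable) also at u, and agreement at u is exactly what antisymmetry needs.
  ¬¬-cong : {A : Set a} (φ : A → Carrier) {u v : A} → ¬ ¬ (u ≡ v) → φ u ≈ φ v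
  ¬¬-cong {A = A} φ {u} {v} ¬¬u≡v = agree (total (φ u) (φ v)) (total (φ v) (φ u))
    (≡.trans (¬¬-congBool (λ w → side (total (φ w) (φ v))))
             (≡.sym (¬¬-congBool (λ w → side (total (φ v) (φ w))))))
    where
      open IsTotalOrder isTotalOrder using (total; antisym)
      side : ∀ {p q} {P : Set p} {Q : Set q} → P ⊎ Q → Bool
      side = [ const true , const false ]′
      ¬¬-congBool : (β : A → Bool) → β u ≡ β v
      ¬¬-congBool β = decidable-stable (β u Bool.≟ β v) (λ βu≢βv → ¬¬u≡v (βu≢βv ∘ cong β))
      agree : (p : φ u ≤ φ v ⊎ φ v ≤ φ u) (q : φ v ≤ φ u ⊎ φ u ≤ φ v) → side p ≡ side q → φ u ≈ φ v
      agree (inj₁ u≤v) (inj₁ v≤u) _  = antisym u≤v v≤u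
      agree (inj₂ v≤u) (inj₂ u≤v) _  = antisym u≤v v≤u
      agree (inj₁ _)   (inj₂ _)   ()
      agree (inj₂ _)   (inj₁ _)   ()

  module Decomposition {z} {Z : Set z} {n : ℕ} {k : Fin n → ℕ}
                       (μ : Weights n k) (pr : ∀ i → IsProbability (k i) (μ i))
                       (ρ : Z → Z → Carrier) (ρ-semimetric : IsSemimetric ρ) where
    open Quantities R μ ρ
    open IsSemimetric ρ-semimetric using (refl0)

    cross diagonal : DT n k Z → DT n k Z → Carrier
    cross    S U = E² μ (λ x y → ρ (eval S x) (eval U y))
    diagonal S U = E μ (λ x → ρ (eval S x) (eval U x))

    SeparatedFrom : DT n k Z → DT n k Z → Set z
    SeparatedFrom S U = ∀ S′ → Subtree S′ S → ∀ x → ¬ (eval S′ x ≡ eval U x) →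
                        ∀ i → i ∈ queried S′ x → i ∈ queried U x → ⊥

    separated-triangle : (S U : DT n k Z) (x y : Input n k) {i : Fin n} →
      (¬ (eval S x ≡ eval U x) → i ∈ queried U x → ⊥) →
      ρ (eval S x) (eval U x) + ρ (eval U x) (eval U (replace i x y)) ≈ ρ (eval S x) (eval U (replace i x y))
    separated-triangle S U x y {i} separated with queriesB U x i in e
    ... | false rewrite eval-replace-unqueried U x y e = trans (+-cong refl (refl0 _)) (+-identityʳ _)
    ... | true = begin
      ρ (eval S x) (eval U x) + ρ (eval U x) (eval U (replace i x y))
        ≈⟨ +-cong (trans (¬¬-cong (λ w → ρ w (eval U x)) Sx≡Ux) (refl0 _)) refl ⟩
      0# + ρ (eval U x) (eval U (replace i x y))
        ≈⟨ +-identityˡ _ ⟩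
      ρ (eval U x) (eval U (replace i x y))
        ≈˘⟨ ¬¬-cong (λ w → ρ w (eval U (replace i x y))) Sx≡Ux ⟩
      ρ (eval S x) (eval U (replace i x y)) ∎
      where
        Sx≡Ux : ¬ ¬ (eval S x ≡ eval U x)
        Sx≡Ux Sx≢Ux = separated Sx≢Ux (queriesB⇒∈queried U x e)

    sumδInf-leaf : (v : Z) (g : Input n k → Z) → sumδInf (leaf v) g ≈ 0#
    sumδInf-leaf v g = trans (sumL-cong (allFin n) (λ j → trans (*-cong (E-zero μ) refl) (zeroˡ _)))
                             (sumL-zero (allFin n))

    module _ {i : Fin n} (s : Fin (k i) → DT n k Z) (fresh : ∀ a x → queriesB (s a) x i ≡ false) where

      cross-node : (U : DT n k Z) → cross (node i s) U ≈ E μ (λ z → cross (s (z i)) U)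
      cross-node U = E-decouple μ pr i (λ a x → E μ (λ y → ρ (eval (s a) x) (eval U y)))
        (λ a x≐x′ → E-cong μ (λ y → reflexive (cong (λ w → ρ w (eval U y)) (eval-cong (s a) x≐x′))))
        (λ a x y → E-cong μ (λ y′ →
          reflexive (cong (λ w → ρ w (eval U y′)) (eval-replace-unqueried (s a) x y (fresh a x)))))

      diagonal-node : (U : DT n k Z) → (∀ x → ¬ (eval (node i s) x ≡ eval U x) → i ∈ queried U x → ⊥) →
                      diagonal (node i s) U + Inf i (eval U) ≈ E μ (λ z → diagonal (s (z i)) U)
      diagonal-node U separated = begin
        diagonal S U + Inf i (eval U)
          ≈˘⟨ +-cong (E-cong μ (λ x → E-const μ pr _)) refl ⟩
        E² μ (λ x y → ρ (eval S x) (eval U x)) + E² μ (λ x y → ρ (eval U x) (eval U (replace i x y)))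
          ≈˘⟨ trans (E-cong μ (λ x → E-+ μ _ _)) (E-+ μ _ _) ⟩
        E² μ (λ x y → ρ (eval S x) (eval U x) + ρ (eval U x) (eval U (replace i x y)))
          ≈⟨ E²-cong μ (λ x y → separated-triangle S U x y (separated x)) ⟩
        E² μ (λ x y → ρ (eval S x) (eval U (replace i x y)))
          ≈⟨ E²-exchange μ i _ (λ x≐x′ y≐y′ →
               reflexive (cong₂ ρ (eval-cong S x≐x′) (eval-cong U (replace-cong i x≐x′ y≐y′)))) ⟩
        E² μ (λ x y → ρ (eval S (replace i x y)) (eval U (replace i (replace i x y) (replace i y x))))
          ≈⟨ E²-cong μ (λ x y → reflexive (cong₂ ρ (S-replace x y) (eval-cong U (replace-involutive i x y)))) ⟩
        E² μ (λ x y → ρ (eval (s (y i)) x) (eval U x))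
          ≈⟨ E-swap μ μ _ ⟩
        E μ (λ z → diagonal (s (z i)) U) ∎
        where
          S = node i s
          S-replace : ∀ x y → eval S (replace i x y) ≡ eval (s (y i)) x
          S-replace x y = ≡.trans (cong (λ a → eval (s a) (replace i x y)) (replace-at i x y))
                                  (eval-replace-unqueried (s (y i)) x y (fresh (y i) x))

      δ-node : ∀ j → δ j (node i s) ≈ indicator ⌊ i ≟ j ⌋ + E μ (λ z → δ j (s (z i)))
      δ-node j = begin
        E μ (λ x → indicator (⌊ i ≟ j ⌋ ∨ queriesB (s (x i)) x j))
          ≈⟨ E-cong μ (λ x → indicator-∨ _ _ (fresh-at x)) ⟩
        E μ (λ x → indicator ⌊ i ≟ j ⌋ + indicator (queriesB (s (x i)) x j))
          ≈⟨ E-+ μ _ _ ⟩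
        E μ (const (indicator ⌊ i ≟ j ⌋)) + E μ (λ x → indicator (queriesB (s (x i)) x j))
          ≈⟨ +-cong (E-const μ pr _) (E-decouple μ pr i (λ a x → indicator (queriesB (s a) x j))
               (λ a x≐x′ → reflexive (cong indicator (queriesB-cong (s a) x≐x′ j)))
               (λ a x y → reflexive (cong indicator (queriesB-replace-unqueried (s a) x y (fresh a x) j)))) ⟩
        indicator ⌊ i ≟ j ⌋ + E μ (λ z → δ j (s (z i))) ∎
        where
          fresh-at : ∀ x → ⌊ i ≟ j ⌋ ≡ true → queriesB (s (x i)) x j ≡ false
          fresh-at x i≟j with i ≟ j
          ... | yes ≡.refl = fresh (x i) x
          fresh-at x () | no _

      sumδInf-node : (g : Input n k → Z) →
        sumδInf (node i s) g ≈ Inf i g + sumL (allFin n) (λ j → E μ (λ z → δ j (s (z i))) * Inf j g)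
      sumδInf-node g = begin
        sumL (allFin n) (λ j → δ j (node i s) * Inf j g)
          ≈⟨ sumL-cong (allFin n) (λ j → trans (*-cong (δ-node j) refl) (distribʳ _ _ _)) ⟩
        sumL (allFin n) (λ j → indicator ⌊ i ≟ j ⌋ * Inf j g + E μ (λ z → δ j (s (z i))) * Inf j g)
          ≈⟨ sumL-+ (allFin n) _ _ ⟩
        sumL (allFin n) (λ j → indicator ⌊ i ≟ j ⌋ * Inf j g)
          + sumL (allFin n) (λ j → E μ (λ z → δ j (s (z i))) * Inf j g)
          ≈⟨ +-cong (sumL-indicator-≟ i (λ j → Inf j g)) refl ⟩
        Inf i g + sumL (allFin n) (λ j → E μ (λ z → δ j (s (z i))) * Inf j g) ∎

    cross-decomposition : ∀ {used} (S U : DT n k Z) → ValidFrom used S → SeparatedFrom S U →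
                          cross S U ≈ diagonal S U + sumδInf S (eval U)
    cross-decomposition (leaf v) U _ _ = begin
      E² μ (λ _ y → ρ v (eval U y))                     ≈⟨ E-const μ pr _ ⟩
      diagonal (leaf v) U                               ≈˘⟨ +-identityʳ _ ⟩
      diagonal (leaf v) U + 0#                          ≈˘⟨ +-cong refl (sumδInf-leaf v (eval U)) ⟩
      diagonal (leaf v) U + sumδInf (leaf v) (eval U)   ∎
    cross-decomposition (node i s) U (node _ _ _ valid) separated = begin
      cross S U
        ≈⟨ cross-node s fresh U ⟩
      E μ (λ z → cross (s (z i)) U)
        ≈⟨ E-cong μ (λ z → cross-decomposition (s (z i)) U (valid (z i))
                                                (λ S′ → separated S′ ∘ there (z i))) ⟩
      E μ (λ z → diagonal (s (z i)) U + sumδInf (s (z i)) (eval U))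
        ≈⟨ E-+ μ _ _ ⟩
      E μ (λ z → diagonal (s (z i)) U) + E μ (λ z → sumδInf (s (z i)) (eval U))
        ≈⟨ +-cong (sym (diagonal-node s fresh U (λ x Sx≢Ux → separated S here x Sx≢Ux i (here ≡.refl))))
                   (trans (E-sumL μ (allFin n) _) (sumL-cong (allFin n) (λ j → E-*ʳ μ _ _))) ⟩
      (diagonal S U + Inf i (eval U)) + sumL (allFin n) (λ j → E μ (λ z → δ j (s (z i))) * Inf j (eval U))
        ≈⟨ +-assoc _ _ _ ⟩
      diagonal S U + (Inf i (eval U) + sumL (allFin n) (λ j → E μ (λ z → δ j (s (z i))) * Inf j (eval U)))
        ≈˘⟨ +-cong refl (sumδInf-node s fresh (eval U)) ⟩
      diagonal S U + sumδInf S (eval U) ∎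
      where
        S = node i s
        fresh : ∀ a x → queriesB (s a) x i ≡ false
        fresh a x = used-unqueried (valid a) (here ≡.refl) x

    diagonal-self : (T : DT n k Z) → diagonal T T ≈ 0#
    diagonal-self T = trans (E-cong μ (λ x → refl0 _)) (E-zero μ)

    Vr-cong : {f g : Input n k → Z} → (∀ x → f x ≡ g x) → Vr f ≈ Vr g
    Vr-cong f≡g = E²-cong μ (λ x y → reflexive (cong₂ ρ (f≡g x) (f≡g y)))

    sumδInf-cong : (T : DT n k Z) {f g : Input n k → Z} → (∀ x → f x ≡ g x) →
                   sumδInf T f ≈ sumδInf T g
    sumδInf-cong T f≡g = sumL-cong (allFin n) (λ j → *-cong refl
      (E²-cong μ (λ x y → reflexive (cong₂ ρ (f≡g x) (f≡g (replace j x y))))))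

mainTheorem9 : ∀ {c ℓ₁ ℓ₂ z} (R : OrderedCommRing c ℓ₁ ℓ₂)
    (n : ℕ) (k : Fin n → ℕ)
    (μ : (i : Fin n) → Fin (k i) → OrderedCommRing.Carrier R)
    → (∀ i → Prob.IsProbability R (k i) (μ i))
    → {Z : Set z} (ρ : Z → Z → OrderedCommRing.Carrier R)
    → Prob.IsSemimetric R ρ
    → (f : Input n k → Z) (T : DT n k Z)
    → IsDDT T → Separated T → Computes T f
    → OrderedCommRing._≈_ R (Quantities.Vr R μ ρ f) (Quantities.sumδInf R μ ρ T f)
mainTheorem9 R n k μ pr ρ ρ-semimetric f T ddt separated computes = begin
  Vr f                                ≈⟨ Vr-cong (≡.sym ∘ computes) ⟩
  Vr (eval T)                         ≈⟨ cross-decomposition T T ddt (λ S′ S′⊑T → separated S′ T S′⊑T here) ⟩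
  diagonal T T + sumδInf T (eval T)   ≈⟨ +-cong (diagonal-self T) (sumδInf-cong T computes) ⟩
  0# + sumδInf T f                    ≈⟨ +-identityˡ _ ⟩
  sumδInf T f                         ∎
  where
    open OrderedCommRing R using (setoid; 0#; _+_; +-cong; +-identityˡ)
    open ≈-Reasoning setoid
    open Quantities R μ ρ using (Vr; sumδInf)
    open Decomposition R μ pr ρ ρ-semimetric
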